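{- For every $n\ge1$ and every word $u\in\{0,1\}^{2n}$ that ends in $1$ and contains no factor $11$, there exists a natural number $N$ with $\beta^-(N)=u$.
   Context: Let $\varphi=(1+\sqrt5)/2$. Every integer $N\ge1$ has a unique base phi expansion $N=\sum_{i\in\mathbb Z} d_i\varphi^i$ with $d_i\in\{0,1\}$, finitely many nonzero, and $d_id_{i+1}=0$ for all $i$; with $R$ the smallest index with $d_R=1$, $\beta^-(N)=d_{ -1}d_{ -2}\cdots d_R$ (empty if $R\ge0$). -}

module Defs where

open import Data.Bool using (Bool; true; false)
open import Data.Nat using (ℕ; zero; suc)
open import Data.Integer using (ℤ; +_; -[1+_]; _+_; _*_)
open import Data.List using (List; []; _∷_; _++_; reverse)
open import Data.Product using (∃; ∃-syntax; _×_; _,_)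
open import Relation.Nullary using (¬_)
open import Relation.Binary.PropositionalEquality using (_≡_)

-- mkφ a b represents a + b·φ of ℤ[φ] (φ² = φ + 1); {1, φ} is a ℤ-basis of ℤ[φ] ⊂ ℝ,
-- so equality of reals in ℤ[φ] is equality of coefficient pairs.
record ℤφ : Set where
  constructor mkφ
  field
    re : ℤ
    ph : ℤ

_⊕_ : ℤφ → ℤφ → ℤφ
mkφ a b ⊕ mkφ c d = mkφ (a + c) (b + d)

-- (a + bφ)(c + dφ) = (ac + bd) + (ad + bc + bd)φ
_⊗_ : ℤφ → ℤφ → ℤφ
mkφ a b ⊗ mkφ c d = mkφ (a * c + b * d) (a * d + b * c + b * d)

zeroφ oneφ φ φ⁻¹ : ℤφ
zeroφ = mkφ (+ 0) (+ 0)
oneφ = mkφ (+ 1) (+ 0)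
φ = mkφ (+ 0) (+ 1)
φ⁻¹ = mkφ -[1+ 0 ] (+ 1)

fromℕ : ℕ → ℤφ
fromℕ n = mkφ (+ n) (+ 0)

φ^ : ℕ → ℤφ
φ^ zero = oneφ
φ^ (suc k) = φ ⊗ φ^ k

φ^- : ℕ → ℤφ
φ^- zero = oneφ
φ^- (suc k) = φ⁻¹ ⊗ φ^- k

digit : Bool → ℤφ
digit true = oneφ
digit false = zeroφ

posValue : ℕ → List Bool → ℤφ
posValue k [] = zeroφ
posValue k (d ∷ ds) = (digit d ⊗ φ^ k) ⊕ posValue (suc k) ds

negValue : ℕ → List Bool → ℤφ
negValue k [] = zeroφ
negValue k (d ∷ ds) = (digit d ⊗ φ^- (suc k)) ⊕ negValue (suc k) ds

NoFactor11 : List Bool → Set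
NoFactor11 w = ¬ (∃[ xs ] ∃[ ys ] (w ≡ xs ++ (true ∷ true ∷ ys)))

-- A base-phi expansion of N, given by
--   neg = d_{-1} d_{-2} ... d_{-m}   and   pos = d_0 d_1 ... d_k
-- (all other digits 0): digits in {0,1}, d_i d_{i+1} = 0 for all i,
-- and N = Σ d_i φ^i.
IsPhiExpansion : ℕ → List Bool → List Bool → Set
IsPhiExpansion N neg pos =
  NoFactor11 (reverse neg ++ pos) × (negValue 0 neg ⊕ posValue 0 pos ≡ fromℕ N)

stripTrailing0 : List Bool → List Bool
stripTrailing0 [] = []
stripTrailing0 (x ∷ xs) with stripTrailing0 xs
... | [] with x
...   | true = true ∷ []
...   | false = []
stripTrailing0 (x ∷ xs) | y ∷ ys = x ∷ y ∷ ys

-- β⁻(N) = w  :  the (unique) base-phi expansion of N has negative part w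
BetaMinusIs : ℕ → List Bool → Set
BetaMinusIs N w = ∃[ neg ] ∃[ pos ] (IsPhiExpansion N neg pos × stripTrailing0 neg ≡ w)

-- Write Fₙ, Lₙ for the Fibonacci and Lucas numbers. Since φⁿ = Fₙ₋₁ + Fₙφ and
-- φ⁻ⁿ = (-1)ⁿ (Fₙ₊₁ - Fₙφ), we have φʲ + φ⁻ʲ = Lⱼ for even j and φ⁻ʲ + Lⱼ = φʲ for odd j.
-- Prefix u with a 0 at position 0 and cut it into blocks 00, 01, 10 at positions -j, -(j+1)
-- (j even), followed by a final 1. A transducer with carry c·φʲ (c ∈ {0,1}) emits the
-- digits at positions j, j+1 so that the block, the incoming carry and the emitted digits
-- add up to an integer plus the outgoing carry φʲ⁺²; the emitted word has no factor 11.
-- Starting with carry φ⁰ = 1, the whole sum is an integer T, and N = T - 1 has expansion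
-- with negative part u. The part of the sum from positions ±j on is an integer ≥ Lⱼ, and
-- L₀ = 2 gives N ≥ 1.

module Submission where

open import Defs
open import Data.Bool using (Bool; true; false)
open import Data.Nat using (ℕ; zero; suc; _+_; _*_; _≤_; s≤s; z≤n)
import Data.Nat.Properties as ℕ
open import Data.Integer as ℤ using (+_; -_; -[1+_])
import Data.Integer.Properties as ℤ
open import Data.List using (List; []; _∷_; _++_; length; last; reverse)
import Data.List.Properties as List
open import Data.Maybe using (just)
open import Data.Product using (∃-syntax; _×_; _,_)
open import Data.Empty using (⊥-elim)
open import Relation.Nullary using (¬_)
open import Relation.Binary.PropositionalEquality
  using (_≡_; refl; sym; trans; cong; cong₂; subst; module ≡-Reasoning)
open import Relation.Binary.PropositionalEquality.Algebra using (isMagma)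
open import Algebra.Bundles using (CommutativeSemigroup; AbelianGroup)
import Algebra.Properties.CommutativeSemigroup as CommSemigroupProperties
open import Algebra.Properties.Group (AbelianGroup.group ℤ.+-0-abelianGroup) using (∙-cancelˡ; //-rightDividesʳ)
open import Data.Integer.Tactic.RingSolver using (solve-∀)

open ≡-Reasoning

⊕-assoc : ∀ x y z → (x ⊕ y) ⊕ z ≡ x ⊕ (y ⊕ z)
⊕-assoc (mkφ a b) (mkφ c d) (mkφ e f) = cong₂ mkφ (ℤ.+-assoc a c e) (ℤ.+-assoc b d f)

⊕-comm : ∀ x y → x ⊕ y ≡ y ⊕ x
⊕-comm (mkφ a b) (mkφ c d) = cong₂ mkφ (ℤ.+-comm a c) (ℤ.+-comm b d)

⊕-identityˡ : ∀ x → zeroφ ⊕ x ≡ x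
⊕-identityˡ (mkφ a b) = cong₂ mkφ (ℤ.+-identityˡ a) (ℤ.+-identityˡ b)

⊕-cancelˡ : ∀ z {x y} → z ⊕ x ≡ z ⊕ y → x ≡ y
⊕-cancelˡ (mkφ a b) {mkφ c d} {mkφ e f} eq =
  cong₂ mkφ (∙-cancelˡ a c e (cong ℤφ.re eq)) (∙-cancelˡ b d f (cong ℤφ.ph eq))

⊕-commutativeSemigroup : CommutativeSemigroup _ _
⊕-commutativeSemigroup = record
  { isCommutativeSemigroup = record
    { isSemigroup = record { isMagma = isMagma _⊕_ ; assoc = ⊕-assoc }
    ; comm = ⊕-comm
    }
  }

open CommSemigroupProperties ⊕-commutativeSemigroup using (interchange; x∙yz≈y∙xz)
open CommSemigroupProperties ℕ.+-commutativeSemigroup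
  using () renaming (interchange to +-interchange; xy∙z≈y∙xz to +-xy∙z≈y∙xz)

xy∙zw≡x∙[yz∙w] : ∀ x y z w → (x ⊕ y) ⊕ (z ⊕ w) ≡ x ⊕ ((y ⊕ z) ⊕ w)
xy∙zw≡x∙[yz∙w] x y z w = trans (⊕-assoc x y (z ⊕ w)) (cong (x ⊕_) (sym (⊕-assoc y z w)))

xy∙zw≡x∙[z∙yw] : ∀ x y z w → (x ⊕ y) ⊕ (z ⊕ w) ≡ x ⊕ (z ⊕ (y ⊕ w))
xy∙zw≡x∙[z∙yw] x y z w = trans (⊕-assoc x y (z ⊕ w)) (cong (x ⊕_) (x∙yz≈y∙xz y z w))

xy∙zw≡yz∙xw : ∀ x y z w → (x ⊕ y) ⊕ (z ⊕ w) ≡ (y ⊕ z) ⊕ (x ⊕ w)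
xy∙zw≡yz∙xw x y z w = trans (cong (_⊕ (z ⊕ w)) (⊕-comm x y)) (interchange y x z w)

⊗-identityˡ : ∀ x → oneφ ⊗ x ≡ x
⊗-identityˡ (mkφ a b) = cong₂ mkφ (re a b) (ph a b)
  where
  re : ∀ a b → + 1 ℤ.* a ℤ.+ + 0 ℤ.* b ≡ a
  re = solve-∀
  ph : ∀ a b → + 1 ℤ.* b ℤ.+ + 0 ℤ.* a ℤ.+ + 0 ℤ.* b ≡ b
  ph = solve-∀

φ-⊗ : ∀ a b → φ ⊗ mkφ a b ≡ mkφ b (a ℤ.+ b)
φ-⊗ a b = cong₂ mkφ (re a b) (ph a b)
  where
  re : ∀ a b → + 0 ℤ.* a ℤ.+ + 1 ℤ.* b ≡ b
  re = solve-∀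
  ph : ∀ a b → + 0 ℤ.* b ℤ.+ + 1 ℤ.* a ℤ.+ + 1 ℤ.* b ≡ a ℤ.+ b
  ph = solve-∀

φ⁻¹-⊗ : ∀ a b → φ⁻¹ ⊗ mkφ a b ≡ mkφ (b ℤ.- a) a
φ⁻¹-⊗ a b = cong₂ mkφ (re a b) (ph a b)
  where
  re : ∀ a b → -[1+ 0 ] ℤ.* a ℤ.+ + 1 ℤ.* b ≡ b ℤ.- a
  re = solve-∀
  ph : ∀ a b → -[1+ 0 ] ℤ.* b ℤ.+ + 1 ℤ.* a ℤ.+ + 1 ℤ.* b ≡ a
  ph = solve-∀

prevFib fib : ℕ → ℕ
prevFib zero = 1
prevFib (suc n) = fib n
fib zero = 0
fib (suc n) = prevFib n + fib n

lucas : ℕ → ℕ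
lucas n = prevFib n + fib (suc n)

lucas-+2 : ∀ n → lucas (2 + n) ≡ lucas n + lucas (1 + n)
lucas-+2 n = +-interchange (prevFib n) (prevFib (1 + n)) (fib (1 + n)) (fib (2 + n))

double : ℕ → ℕ
double zero = zero
double (suc k) = suc (suc (double k))

φ^-closed : ∀ n → φ^ n ≡ mkφ (+ prevFib n) (+ fib n)
φ^-closed zero = refl
φ^-closed (suc n) = trans (cong (φ ⊗_) (φ^-closed n)) (φ-⊗ (+ prevFib n) (+ fib n))

φ^-even-closed : ∀ k → φ^- (double k) ≡ mkφ (+ fib (1 + double k)) (- + fib (double k))
φ^-odd-closed : ∀ k → φ^- (1 + double k) ≡ mkφ (- + fib (2 + double k)) (+ fib (1 + double k))
φ^-even-closed zero = refl
φ^-even-closed (suc k) = begin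
  φ⁻¹ ⊗ φ^- (1 + j)
    ≡⟨ cong (φ⁻¹ ⊗_) (φ^-odd-closed k) ⟩
  φ⁻¹ ⊗ mkφ (- F (2 + j)) (F (1 + j))
    ≡⟨ φ⁻¹-⊗ (- F (2 + j)) (F (1 + j)) ⟩
  mkφ (F (1 + j) ℤ.- - F (2 + j)) (- F (2 + j))
    ≡⟨ cong (λ a → mkφ (F (1 + j) ℤ.+ a) (- F (2 + j))) (ℤ.neg-involutive (F (2 + j))) ⟩
  mkφ (F (3 + j)) (- F (2 + j)) ∎
  where j = double k
        F = λ n → + fib n
φ^-odd-closed k = begin
  φ⁻¹ ⊗ φ^- j
    ≡⟨ cong (φ⁻¹ ⊗_) (φ^-even-closed k) ⟩
  φ⁻¹ ⊗ mkφ (F (1 + j)) (- F j)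
    ≡⟨ φ⁻¹-⊗ (F (1 + j)) (- F j) ⟩
  mkφ (- F j ℤ.- F (1 + j)) (F (1 + j))
    ≡⟨ cong (λ a → mkφ a (F (1 + j))) (sym (ℤ.neg-distrib-+ (F j) (F (1 + j)))) ⟩
  mkφ (- F (2 + j)) (F (1 + j)) ∎
  where j = double k
        F = λ n → + fib n

φ^-+φ^ : ∀ n → φ^ n ⊕ φ^ (1 + n) ≡ φ^ (2 + n)
φ^-+φ^ n = trans (cong₂ _⊕_ (φ^-closed n) (φ^-closed (1 + n))) (sym (φ^-closed (2 + n)))

lucas-even : ∀ k → φ^ (double k) ⊕ φ^- (double k) ≡ fromℕ (lucas (double k))
lucas-even k = begin
  φ^ j ⊕ φ^- j
    ≡⟨ cong₂ _⊕_ (φ^-closed j) (φ^-even-closed k) ⟩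
  mkφ (+ lucas j) (+ fib j ℤ.- + fib j)
    ≡⟨ cong (mkφ (+ lucas j)) (ℤ.+-inverseʳ (+ fib j)) ⟩
  fromℕ (lucas j) ∎
  where j = double k

lucas-odd : ∀ k → fromℕ (lucas (1 + double k)) ⊕ φ^- (1 + double k) ≡ φ^ (1 + double k)
lucas-odd k = begin
  fromℕ (lucas (1 + j)) ⊕ φ^- (1 + j)
    ≡⟨ cong (fromℕ (lucas (1 + j)) ⊕_) (φ^-odd-closed k) ⟩
  mkφ (F j ℤ.+ F (2 + j) ℤ.- F (2 + j)) (+ 0 ℤ.+ F (1 + j))
    ≡⟨ cong₂ mkφ (//-rightDividesʳ (F (2 + j)) (F j)) (ℤ.+-identityˡ (F (1 + j))) ⟩
  mkφ (F j) (F (1 + j))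
    ≡⟨ sym (φ^-closed (1 + j)) ⟩
  φ^ (1 + j) ∎
  where j = double k
        F = λ n → + fib n

IntegerAtLeast : ℕ → ℤφ → Set
IntegerAtLeast n x = ∃[ m ] x ≡ fromℕ (n + m)

integerAtLeast-lucas-+2 : ∀ n {x} → IntegerAtLeast (lucas (2 + n)) x → IntegerAtLeast (lucas n) x
integerAtLeast-lucas-+2 n (m , eq) = lucas (1 + n) + m , trans eq (cong fromℕ (begin
  lucas (2 + n) + m               ≡⟨ cong (_+ m) (lucas-+2 n) ⟩
  (lucas n + lucas (1 + n)) + m   ≡⟨ ℕ.+-assoc (lucas n) (lucas (1 + n)) m ⟩
  lucas n + (lucas (1 + n) + m)   ∎))

carry-pass : ∀ j {x} → IntegerAtLeast (lucas (2 + j)) (φ^ (2 + j) ⊕ x) →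
             IntegerAtLeast (lucas j) ((φ^ j ⊕ φ^ (1 + j)) ⊕ x)
carry-pass j {x} h =
  integerAtLeast-lucas-+2 j (subst (λ y → IntegerAtLeast (lucas (2 + j)) (y ⊕ x)) (sym (φ^-+φ^ j)) h)

absorb-even : ∀ k {n x} → IntegerAtLeast n x →
              IntegerAtLeast (lucas (double k)) ((φ^ (double k) ⊕ φ^- (double k)) ⊕ x)
absorb-even k {n} (m , eq) = n + m , cong₂ _⊕_ (lucas-even k) eq

absorb-odd : ∀ k {x} → IntegerAtLeast (lucas (2 + double k)) (φ^ (2 + double k) ⊕ x) →
             IntegerAtLeast (lucas (double k)) ((φ^ (double k) ⊕ φ^- (1 + double k)) ⊕ x)
absorb-odd k {x} (m , eq) = m , ⊕-cancelˡ L′ (begin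
  L′ ⊕ ((φ^ j ⊕ φ^- (1 + j)) ⊕ x)       ≡⟨ sym (⊕-assoc L′ (φ^ j ⊕ φ^- (1 + j)) x) ⟩
  (L′ ⊕ (φ^ j ⊕ φ^- (1 + j))) ⊕ x       ≡⟨ cong (_⊕ x) (x∙yz≈y∙xz L′ (φ^ j) (φ^- (1 + j))) ⟩
  (φ^ j ⊕ (L′ ⊕ φ^- (1 + j))) ⊕ x       ≡⟨ cong (λ y → (φ^ j ⊕ y) ⊕ x) (lucas-odd k) ⟩
  (φ^ j ⊕ φ^ (1 + j)) ⊕ x               ≡⟨ cong (_⊕ x) (φ^-+φ^ j) ⟩
  φ^ (2 + j) ⊕ x                        ≡⟨ eq ⟩
  fromℕ (lucas (2 + j) + m)             ≡⟨ cong (λ l → fromℕ (l + m)) (lucas-+2 j) ⟩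
  fromℕ ((lucas j + lucas (1 + j)) + m) ≡⟨ cong fromℕ (+-xy∙z≈y∙xz (lucas j) (lucas (1 + j)) m) ⟩
  L′ ⊕ fromℕ (lucas j + m)              ∎)
  where j = double k
        L′ = fromℕ (lucas (1 + j))

valueWith : (ℕ → ℤφ) → ℕ → List Bool → ℤφ
valueWith w j [] = zeroφ
valueWith w j (false ∷ ds) = valueWith w (suc j) ds
valueWith w j (true ∷ ds) = w j ⊕ valueWith w (suc j) ds

posValue≡valueWith : ∀ j ds → posValue j ds ≡ valueWith φ^ j ds
posValue≡valueWith j [] = refl
posValue≡valueWith j (false ∷ ds) = trans (⊕-identityˡ _) (posValue≡valueWith (suc j) ds)
posValue≡valueWith j (true ∷ ds) = cong₂ _⊕_ (⊗-identityˡ (φ^ j)) (posValue≡valueWith (suc j) ds)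

negValue≡valueWith : ∀ j ds → negValue j ds ≡ valueWith φ^- (suc j) ds
negValue≡valueWith j [] = refl
negValue≡valueWith j (false ∷ ds) = trans (⊕-identityˡ _) (negValue≡valueWith (suc j) ds)
negValue≡valueWith j (true ∷ ds) = cong₂ _⊕_ (⊗-identityˡ (φ^- (suc j))) (negValue≡valueWith (suc j) ds)

data Blocks : List Bool → Set where
  [1]  : Blocks (true ∷ [])
  00∷_ : ∀ {v} → Blocks v → Blocks (false ∷ false ∷ v)
  01∷_ : ∀ {v} → Blocks v → Blocks (false ∷ true ∷ v)
  10∷_ : ∀ {v} → Blocks v → Blocks (true ∷ false ∷ v)

-- emit c b: the digits at positions j, j+1, … answering the blocks b read from position -j on,
-- when the digits already read leave the carry c·φʲ.
emit : Bool → ∀ {v} → Blocks v → List Bool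
emit true  [1]      = false ∷ []
emit false [1]      = true ∷ []
emit true  (00∷ b)  = false ∷ true ∷ emit true b
emit true  (01∷ b)  = false ∷ false ∷ emit true b
emit true  (10∷ b)  = false ∷ false ∷ emit false b
emit false (00∷ b)  = false ∷ false ∷ emit false b
emit false (01∷ b)  = true ∷ false ∷ emit true b
emit false (10∷ b)  = true ∷ false ∷ emit false b

withCarry : Bool → ℕ → ℤφ → ℤφ
withCarry true  j x = φ^ j ⊕ x
withCarry false j x = x

balance : ∀ c k {v} (b : Blocks v) →
  IntegerAtLeast (lucas (double k))
    (withCarry c (double k) (valueWith φ^- (double k) v ⊕ valueWith φ^ (double k) (emit c b)))
balance true k [1] =
  subst (IntegerAtLeast _) (xy∙zw≡x∙[yz∙w] (φ^ j) (φ^- j) zeroφ zeroφ) (absorb-even k (0 , refl))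
  where j = double k
balance false k [1] =
  subst (IntegerAtLeast _) (xy∙zw≡yz∙xw (φ^ j) (φ^- j) zeroφ zeroφ) (absorb-even k (0 , refl))
  where j = double k
balance true k (00∷_ {v} b) =
  subst (IntegerAtLeast _) (xy∙zw≡x∙[z∙yw] (φ^ j) (φ^ (1 + j)) R P) (carry-pass j (balance true (suc k) b))
  where j = double k
        R = valueWith φ^- (2 + j) v
        P = valueWith φ^ (2 + j) (emit true b)
balance true k (01∷_ {v} b) =
  subst (IntegerAtLeast _) (xy∙zw≡x∙[yz∙w] (φ^ j) (φ^- (1 + j)) R P) (absorb-odd k (balance true (suc k) b))
  where j = double k
        R = valueWith φ^- (2 + j) v
        P = valueWith φ^ (2 + j) (emit true b)
balance true k (10∷_ {v} b) =
  subst (IntegerAtLeast _) (xy∙zw≡x∙[yz∙w] (φ^ j) (φ^- j) R P) (absorb-even k (balance false (suc k) b))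
  where j = double k
        R = valueWith φ^- (2 + j) v
        P = valueWith φ^ (2 + j) (emit false b)
balance false k (00∷ b) = integerAtLeast-lucas-+2 (double k) (balance false (suc k) b)
balance false k (01∷_ {v} b) =
  subst (IntegerAtLeast _) (xy∙zw≡yz∙xw (φ^ j) (φ^- (1 + j)) R P) (absorb-odd k (balance true (suc k) b))
  where j = double k
        R = valueWith φ^- (2 + j) v
        P = valueWith φ^ (2 + j) (emit true b)
balance false k (10∷_ {v} b) =
  subst (IntegerAtLeast _) (xy∙zw≡yz∙xw (φ^ j) (φ^- j) R P) (absorb-even k (balance false (suc k) b))
  where j = double k
        R = valueWith φ^- (2 + j) v
        P = valueWith φ^ (2 + j) (emit false b)

data No11 : List Bool → Set where
  []   : No11 []
  [1]  : No11 (true ∷ [])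
  0∷_  : ∀ {w} → No11 w → No11 (false ∷ w)
  10∷_ : ∀ {w} → No11 w → No11 (true ∷ false ∷ w)

No11⇒NoFactor11 : ∀ {w} → No11 w → NoFactor11 w
No11⇒NoFactor11 h (xs , ys , refl) = no11 xs h
  where
  no11 : ∀ xs {ys} → ¬ No11 (xs ++ true ∷ true ∷ ys)
  no11 []                  ()
  no11 (false ∷ xs)        (0∷ h)  = no11 xs h
  no11 (true ∷ [])         ()
  no11 (true ∷ false ∷ xs) (10∷ h) = no11 xs h

NoFactor11-∷ : ∀ a {w} → NoFactor11 (a ∷ w) → NoFactor11 w
NoFactor11-∷ a h (xs , ys , eq) = h (a ∷ xs , ys , cong (a ∷_) eq)

NoFactor11⇒No11 : ∀ w → NoFactor11 w → No11 w
NoFactor11⇒No11 []                  h = []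
NoFactor11⇒No11 (false ∷ w)         h = 0∷ NoFactor11⇒No11 w (NoFactor11-∷ false h)
NoFactor11⇒No11 (true ∷ [])         h = [1]
NoFactor11⇒No11 (true ∷ false ∷ w)  h = 10∷ NoFactor11⇒No11 w (NoFactor11-∷ false (NoFactor11-∷ true h))
NoFactor11⇒No11 (true ∷ true ∷ w)   h = ⊥-elim (h ([] , w , refl))

NoFactor11-reverse : ∀ w → NoFactor11 w → NoFactor11 (reverse w)
NoFactor11-reverse w h (xs , ys , eq) = h (reverse ys , reverse xs , (begin
  w                                                 ≡⟨ sym (List.reverse-involutive w) ⟩
  reverse (reverse w)                               ≡⟨ cong reverse eq ⟩
  reverse (xs ++ (true ∷ true ∷ []) ++ ys)          ≡⟨ List.reverse-++ xs _ ⟩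
  reverse ((true ∷ true ∷ []) ++ ys) ++ reverse xs  ≡⟨ cong (_++ reverse xs) (List.reverse-++ (true ∷ true ∷ []) ys) ⟩
  (reverse ys ++ true ∷ true ∷ []) ++ reverse xs    ≡⟨ List.++-assoc (reverse ys) _ (reverse xs) ⟩
  reverse ys ++ true ∷ true ∷ reverse xs            ∎))

No11-++ : ∀ {xs ys} → No11 xs → No11 (true ∷ ys) → No11 (xs ++ ys)
No11-++ []       [1]      = []
No11-++ []       (10∷ h)  = 0∷ h
No11-++ [1]      h        = h
No11-++ (0∷ g)   h        = 0∷ No11-++ g h
No11-++ (10∷ g)  h        = 10∷ No11-++ g h

No11-emit : ∀ c {v} (b : Blocks v) → No11 (emit c b)
No11-1∷emit : ∀ {v} (b : Blocks v) → No11 (true ∷ emit true b)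
No11-emit true  [1]     = 0∷ []
No11-emit false [1]     = [1]
No11-emit true  (00∷ b) = 0∷ No11-1∷emit b
No11-emit true  (01∷ b) = 0∷ 0∷ No11-emit true b
No11-emit true  (10∷ b) = 0∷ 0∷ No11-emit false b
No11-emit false (00∷ b) = 0∷ 0∷ No11-emit false b
No11-emit false (01∷ b) = 10∷ No11-emit true b
No11-emit false (10∷ b) = 10∷ No11-emit false b
No11-1∷emit [1]     = 10∷ []
No11-1∷emit (00∷ b) = 10∷ No11-1∷emit b
No11-1∷emit (01∷ b) = 10∷ 0∷ No11-emit true b
No11-1∷emit (10∷ b) = 10∷ 0∷ No11-emit false b

2+m≡2*[1+n]⇒m≡2*n : ∀ n {m} → 2 + m ≡ 2 * suc n → m ≡ 2 * n
2+m≡2*[1+n]⇒m≡2*n n eq = ℕ.suc-injective (ℕ.suc-injective (trans eq (ℕ.*-suc 2 n)))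

blocks : ∀ n {a u} → length u ≡ 2 * n → last (a ∷ u) ≡ just true → No11 (a ∷ u) → Blocks (a ∷ u)
blocks zero    {u = []}        _   refl _ = [1]
blocks (suc n) {u = _ ∷ []}    len _    _ = ⊥-elim (ℕ.0≢1+n (ℕ.suc-injective (trans len (ℕ.*-suc 2 n))))
blocks (suc n) {u = _ ∷ _ ∷ _} len lst (0∷ 0∷ h)  = 00∷ blocks n (2+m≡2*[1+n]⇒m≡2*n n len) lst h
blocks (suc n) {u = _ ∷ _ ∷ _} len lst (0∷ 10∷ h) = 01∷ blocks n (2+m≡2*[1+n]⇒m≡2*n n len) lst (0∷ h)
blocks (suc n) {u = _ ∷ _ ∷ _} len lst (10∷ h)    = 10∷ blocks n (2+m≡2*[1+n]⇒m≡2*n n len) lst h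

last-∷ : ∀ (a : Bool) {u x} → last u ≡ just x → last (a ∷ u) ≡ just x
last-∷ a {[]}    ()
last-∷ a {_ ∷ _} h = h

stripTrailing0-last : ∀ w → last w ≡ just true → stripTrailing0 w ≡ w
stripTrailing0-last (_ ∷ [])    refl = refl
stripTrailing0-last (x ∷ y ∷ w) h rewrite stripTrailing0-last (y ∷ w) h = refl

phiExpansion : ∀ {u} (b : Blocks (false ∷ u)) → NoFactor11 u → ∃[ m ] IsPhiExpansion (suc m) u (emit true b)
phiExpansion {u} b nf with balance true 0 b
... | m , eq = m , digits , value
  where
  digits : NoFactor11 (reverse u ++ emit true b)
  digits = No11⇒NoFactor11 (No11-++ (NoFactor11⇒No11 _ (NoFactor11-reverse u nf)) (No11-1∷emit b))
  value : negValue 0 u ⊕ posValue 0 (emit true b) ≡ fromℕ (suc m)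
  value = begin
    negValue 0 u ⊕ posValue 0 (emit true b)
      ≡⟨ cong₂ _⊕_ (negValue≡valueWith 0 u) (posValue≡valueWith 0 (emit true b)) ⟩
    valueWith φ^- 1 u ⊕ valueWith φ^ 0 (emit true b)  ≡⟨ ⊕-cancelˡ oneφ eq ⟩
    fromℕ (suc m)                                      ∎

theorem7p3 : (n : ℕ) → 1 ≤ n → (u : List Bool) → length u ≡ 2 * n →
    last u ≡ just true → NoFactor11 u →
    ∃[ N ] (1 ≤ N × BetaMinusIs N u)
theorem7p3 n _ u len lst nf with phiExpansion (blocks n len (last-∷ false {u} lst) (0∷ NoFactor11⇒No11 u nf)) nf
... | m , expansion = suc m , s≤s z≤n , u , _ , expansion , stripTrailing0-last u lst
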